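{- Let $S$ be a general position set of a maximal outerplane graph $G$. If $|S|\geq 4$, then the induced subgraph $G[S]$ contains no triangle.
   Context: All graphs are finite, simple, undirected and connected. A set $R\subseteq V(G)$ is a general position set of $G$ if no three distinct vertices of $R$ are such that one of them lies on a shortest path (geodesic) in $G$ between the other two. A maximal outerplane graph is a maximal outerplanar graph (an outerplanar graph to which no edge can be added preserving outerplanarity) embedded in the plane with all vertices on the outer face. $G[S]$ is the subgraph induced by $S$. -}

module Defs where

open import Data.Nat using (ℕ; zero; suc; _<_)
open import Data.Fin using (Fin; toℕ)
open import Data.Fin.Subset using (Subset; _∈_)
open import Data.Product using (Σ; ∃; ∃-syntax; _×_; _,_)
open import Data.Sum using (_⊎_)
open import Data.Empty using (⊥)
open import Relation.Nullary using (¬_)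
open import Relation.Binary.PropositionalEquality using (_≡_; _≢_)
open import Function.Definitions using (Injective)

record Graph (n : ℕ) : Set₁ where
  field
    Adj     : Fin n → Fin n → Set
    symm    : ∀ {u v} → Adj u v → Adj v u
    irrefl  : ∀ {u} → ¬ Adj u u
open Graph public

data Walk {n : ℕ} (G : Graph n) : Fin n → Fin n → ℕ → Set where
  [_]  : (u : Fin n) → Walk G u u zero
  _∷_  : ∀ {u w v k} → Adj G u w → Walk G w v k → Walk G u v (suc k)

data OnWalk {n : ℕ} {G : Graph n} (x : Fin n) : ∀ {u v k} → Walk G u v k → Set where
  here  : ∀ {v k} {p : Walk G x v k} → OnWalk x p
  there : ∀ {u w v k} {e : Adj G u w} {p : Walk G w v k} → OnWalk x p → OnWalk x (e ∷ p)

Connected : ∀ {n} → Graph n → Set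
Connected {n} G = ∀ (u v : Fin n) → ∃[ k ] Walk G u v k

IsShortest : ∀ {n} (G : Graph n) (u v : Fin n) (k : ℕ) → Set
IsShortest G u v k = ∀ m → m < k → ¬ Walk G u v m

OnGeodesic : ∀ {n} (G : Graph n) (u w v : Fin n) → Set
OnGeodesic G u w v = ∃[ k ] Σ (Walk G u v k) λ p → IsShortest G u v k × OnWalk w p

GeneralPosition : ∀ {n} → Graph n → Subset n → Set
GeneralPosition G R = ∀ x y z → x ∈ R → y ∈ R → z ∈ R →
  x ≢ y → y ≢ z → x ≢ z → ¬ OnGeodesic G x y z

-- Outerplanarity of an edge relation, in the combinatorial form of a drawing
-- with all vertices on a circle (outer face) and edges as non-crossing chords:
-- pos gives the cyclic position of each vertex on the circle.
Crossing : ∀ {n} → (Fin n → Fin n) → Fin n → Fin n → Fin n → Fin n → Set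
Crossing pos a b c d =
  toℕ (pos a) < toℕ (pos c) × toℕ (pos c) < toℕ (pos b) × toℕ (pos b) < toℕ (pos d)

OuterplanarRel : ∀ {n} → (Fin n → Fin n → Set) → Set
OuterplanarRel {n} E = ∃[ pos ] (Injective _≡_ _≡_ pos ×
  (∀ a b c d → E a b → E c d → ¬ Crossing pos a b c d))

AddEdge : ∀ {n} → (Fin n → Fin n → Set) → Fin n → Fin n → Fin n → Fin n → Set
AddEdge E u v x y = E x y ⊎ ((x ≡ u × y ≡ v) ⊎ (x ≡ v × y ≡ u))

MaximalOuterplanar : ∀ {n} → Graph n → Set
MaximalOuterplanar {n} G = OuterplanarRel (Adj G) ×
  (∀ (u v : Fin n) → u ≢ v → ¬ Adj G u v → ¬ OuterplanarRel (AddEdge (Adj G) u v))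

HasTriangleIn : ∀ {n} → Graph n → Subset n → Set
HasTriangleIn G S = ∃[ a ] ∃[ b ] ∃[ c ] (a ∈ S × b ∈ S × c ∈ S ×
  Adj G a b × Adj G b c × Adj G a c)

{-# OPTIONS --safe #-}
-- Draw G with its vertices on a circle. If x, y, z is a triangle of G[S] and d is a
-- fourth vertex of S, then d lies on one of the three arcs cut off by the sides of the
-- triangle. Since edges do not cross, the side bounding that arc separates d from the
-- opposite corner, so every geodesic between them passes through an endpoint of that
-- side: four vertices of S not in general position.
module Submission where

open import Defs
open import Data.Nat using (ℕ; _≥_)
open import Data.Fin.Subset using (Subset; ∣_∣)
open import Relation.Nullary using (¬_)

open import Data.Nat using (_≤_; _<_; z≤n; s≤s; _+_)
open import Data.Nat.Properties
  using (≤-trans; ≤-reflexive; +-monoʳ-≤; n≤1+n; +-suc; <-cmp; <-asym; ≤⇒≯; <-irrefl; <-trans)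
open import Data.Nat.Induction using (<-rec)
open import Data.Vec using (_∷_; [])
open import Data.Bool using (true; false)
open import Data.Fin using (Fin; toℕ; _≟_)
open import Data.Fin.Properties using (toℕ-injective)
open import Data.Fin.Subset using (_∪_; ⁅_⁆; _∈_)
open import Data.Fin.Subset.Properties using (p⊆q⇒∣p∣≤∣q∣; ∣⁅x⁆∣≡1; x∈⁅x⁆; x∈p∪q⁺)
open import Data.Product using (Σ; ∃-syntax; _×_; _,_; proj₂)
open import Data.Sum using (_⊎_; inj₁; inj₂; map; map₁; map₂; swap; assocˡ; assocʳ)
open import Data.Empty using (⊥; ⊥-elim)
open import Function using (_∘_)
open import Function.Definitions using (Injective)
open import Relation.Binary using (tri<; tri≈; tri>)
open import Relation.Nullary using (yes; no)
open import Relation.Binary.PropositionalEquality using (_≡_; _≢_; refl; sym; cong₂; ≢-sym)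

∣p∪q∣≤∣p∣+∣q∣ : ∀ {n} (p q : Subset n) → ∣ p ∪ q ∣ ≤ ∣ p ∣ + ∣ q ∣
∣p∪q∣≤∣p∣+∣q∣ []          []          = z≤n
∣p∪q∣≤∣p∣+∣q∣ (true ∷ p)  (true ∷ q)  =
  s≤s (≤-trans (∣p∪q∣≤∣p∣+∣q∣ p q) (+-monoʳ-≤ ∣ p ∣ (n≤1+n ∣ q ∣)))
∣p∪q∣≤∣p∣+∣q∣ (true ∷ p)  (false ∷ q) = s≤s (∣p∪q∣≤∣p∣+∣q∣ p q)
∣p∪q∣≤∣p∣+∣q∣ (false ∷ p) (true ∷ q)  =
  ≤-trans (s≤s (∣p∪q∣≤∣p∣+∣q∣ p q)) (≤-reflexive (sym (+-suc ∣ p ∣ ∣ q ∣)))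
∣p∪q∣≤∣p∣+∣q∣ (false ∷ p) (false ∷ q) = ∣p∪q∣≤∣p∣+∣q∣ p q

∣⁅x⁆∪⁅y⁆∪⁅z⁆∣≤3 : ∀ {n} (x y z : Fin n) → ∣ ⁅ x ⁆ ∪ ⁅ y ⁆ ∪ ⁅ z ⁆ ∣ ≤ 3
∣⁅x⁆∪⁅y⁆∪⁅z⁆∣≤3 x y z =
  ≤-trans (∣p∪q∣≤∣p∣+∣q∣ ⁅ x ⁆ _)
  (≤-trans (+-monoʳ-≤ ∣ ⁅ x ⁆ ∣ (∣p∪q∣≤∣p∣+∣q∣ ⁅ y ⁆ ⁅ z ⁆))
  (≤-reflexive (cong₂ _+_ (∣⁅x⁆∣≡1 x) (cong₂ _+_ (∣⁅x⁆∣≡1 y) (∣⁅x⁆∣≡1 z)))))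

∣p∣≤3 : ∀ {n} {p : Subset n} {x y z : Fin n} →
  (∀ {d} → d ∈ p → d ≡ x ⊎ d ≡ y ⊎ d ≡ z) → ∣ p ∣ ≤ 3
∣p∣≤3 {x = x} {y} {z} covered =
  ≤-trans (p⊆q⇒∣p∣≤∣q∣ (∈⁅x⁆∪⁅y⁆∪⁅z⁆ ∘ covered)) (∣⁅x⁆∪⁅y⁆∪⁅z⁆∣≤3 x y z)
  where
  ∈⁅x⁆∪⁅y⁆∪⁅z⁆ : ∀ {d} → d ≡ x ⊎ d ≡ y ⊎ d ≡ z → d ∈ ⁅ x ⁆ ∪ ⁅ y ⁆ ∪ ⁅ z ⁆
  ∈⁅x⁆∪⁅y⁆∪⁅z⁆ (inj₁ refl)        = x∈p∪q⁺ (inj₁ (x∈⁅x⁆ x))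
  ∈⁅x⁆∪⁅y⁆∪⁅z⁆ (inj₂ (inj₁ refl)) = x∈p∪q⁺ (inj₂ (x∈p∪q⁺ (inj₁ (x∈⁅x⁆ y))))
  ∈⁅x⁆∪⁅y⁆∪⁅z⁆ (inj₂ (inj₂ refl)) = x∈p∪q⁺ (inj₂ (x∈p∪q⁺ (inj₂ (x∈⁅x⁆ z))))

wlog-sorted : ∀ {a ℓ} {A : Set a} (key : A → ℕ) (Q : A → A → A → Set ℓ) →
  (∀ {x y z} → Q x y z → Q y x z) → (∀ {x y z} → Q x y z → Q x z y) →
  (∀ {x y z} → key x < key y → key y < key z → Q x y z) →
  ∀ {x y z} → key x ≢ key y → key y ≢ key z → key x ≢ key z → Q x y z
wlog-sorted key Q swap₁₂ swap₂₃ sorted {x} {y} {z} x≢y y≢z x≢z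
  with <-cmp (key x) (key y) | <-cmp (key y) (key z) | <-cmp (key x) (key z)
... | tri≈ _ x≡y _ | _            | _            = ⊥-elim (x≢y x≡y)
... | _            | tri≈ _ y≡z _ | _            = ⊥-elim (y≢z y≡z)
... | _            | _            | tri≈ _ x≡z _ = ⊥-elim (x≢z x≡z)
... | tri< x<y _ _ | tri< y<z _ _ | _            = sorted x<y y<z
... | tri< _ _ _   | tri> _ _ z<y | tri< x<z _ _ = swap₂₃ (sorted x<z z<y)
... | tri< x<y _ _ | tri> _ _ _   | tri> _ _ z<x = swap₂₃ (swap₁₂ (sorted z<x x<y))
... | tri> _ _ y<x | tri< _ _ _   | tri< x<z _ _ = swap₁₂ (sorted y<x x<z)
... | tri> _ _ _   | tri< y<z _ _ | tri> _ _ z<x = swap₁₂ (swap₂₃ (sorted y<z z<x))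
... | tri> _ _ y<x | tri> _ _ z<y | _            = swap₁₂ (swap₂₃ (swap₁₂ (sorted z<y y<x)))

module _ {n : ℕ} (G : Graph n) where

  ShortestWalk : Fin n → Fin n → Set
  ShortestWalk u v = ∃[ k ] Σ (Walk G u v k) λ _ → IsShortest G u v k

  -- Adjacency is not decidable, so a walk of minimal length is only obtained classically.
  ¬¬-shortestWalk : ∀ {u v} k → Walk G u v k → ¬ ¬ ShortestWalk u v
  ¬¬-shortestWalk {u} {v} = <-rec (λ k → Walk G u v k → ¬ ¬ ShortestWalk u v)
    λ k shorter p none → none (k , p , λ m m<k q → shorter m<k q none)

  SeparatedBy : Fin n → Fin n → (Fin n → Set) → Set
  SeparatedBy u v P = ∀ {z z'} → Adj G z z' → z' ≢ u → z' ≢ v → P z → P z'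

  walk-meets-separator : ∀ {u v P x t k} → SeparatedBy u v P →
    (p : Walk G x t k) → P x → ¬ P t → OnWalk u p ⊎ OnWalk v p
  walk-meets-separator sep [ x ] px ¬pt = ⊥-elim (¬pt px)
  walk-meets-separator {u} {v} sep (_∷_ {w = w} e p) px ¬pt with w ≟ u | w ≟ v
  ... | yes refl | _        = inj₁ (there here)
  ... | no _     | yes refl = inj₂ (there here)
  ... | no w≢u   | no w≢v   =
    map there there (walk-meets-separator sep p (sep e w≢u w≢v px) ¬pt)

  Triangle : Subset n → Fin n → Fin n → Fin n → Set
  Triangle S x y z = x ∈ S × y ∈ S × z ∈ S × Adj G x y × Adj G y z × Adj G x z

  Triangle-swap₁₂ : ∀ {S x y z} → Triangle S x y z → Triangle S y x z
  Triangle-swap₁₂ (x∈S , y∈S , z∈S , xy , yz , xz) = y∈S , x∈S , z∈S , symm G xy , xz , yz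

  Triangle-swap₂₃ : ∀ {S x y z} → Triangle S x y z → Triangle S x z y
  Triangle-swap₂₃ (x∈S , y∈S , z∈S , xy , yz , xz) = x∈S , z∈S , y∈S , xz , symm G yz , xy

  module _ (connected : Connected G) {S : Subset n} (gp : GeneralPosition G S) where

    general-position-¬separated : ∀ {u v P x t} → SeparatedBy u v P →
      u ∈ S → v ∈ S → x ∈ S → t ∈ S → x ≢ u → x ≢ v → t ≢ u → t ≢ v → P x → ¬ P t → ⊥
    general-position-¬separated {u} {v} {x = x} {t} sep u∈S v∈S x∈S t∈S x≢u x≢v t≢u t≢v px ¬pt =
      ¬¬-shortestWalk _ (proj₂ (connected x t)) no-geodesic
      where
      x≢t : x ≢ t
      x≢t refl = ¬pt px

      no-geodesic : ¬ ShortestWalk x t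
      no-geodesic (k , p , shortest) with walk-meets-separator sep p px ¬pt
      ... | inj₁ on-u = gp x u t x∈S u∈S t∈S x≢u (t≢u ∘ sym) x≢t (k , p , shortest , on-u)
      ... | inj₂ on-v = gp x v t x∈S v∈S t∈S x≢v (t≢v ∘ sym) x≢t (k , p , shortest , on-v)

  module _ (pos : Fin n → Fin n) (pos-injective : Injective _≡_ _≡_ pos)
           (noncrossing : ∀ a b c d → Adj G a b → Adj G c d → ¬ Crossing pos a b c d) where

    key : Fin n → ℕ
    key = toℕ ∘ pos

    key-injective : ∀ {x y} → key x ≡ key y → x ≡ y
    key-injective = pos-injective ∘ toℕ-injective

    key<⇒≢ : ∀ {x y} → key x < key y → x ≢ y
    key<⇒≢ x<y refl = <-irrefl refl x<y

    adjacent⇒key≢ : ∀ {x y} → Adj G x y → key x ≢ key y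
    adjacent⇒key≢ xy eq with key-injective eq
    ... | refl = irrefl G xy

    Between : Fin n → Fin n → Fin n → Set
    Between u v z = key u < key z × key z < key v

    Beyond : Fin n → Fin n → Fin n → Set
    Beyond u v z = key z < key u ⊎ key v < key z

    Beyond⇒¬Between : ∀ {u v z} → Beyond u v z → ¬ Between u v z
    Beyond⇒¬Between (inj₁ z<u) (u<z , _)   = <-asym z<u u<z
    Beyond⇒¬Between (inj₂ v<z) (_   , z<v) = <-asym v<z z<v

    Beyond⇒≢ₗ : ∀ {u v z} → key u < key v → Beyond u v z → z ≢ u
    Beyond⇒≢ₗ _   (inj₁ u<u) refl = <-irrefl refl u<u
    Beyond⇒≢ₗ u<v (inj₂ v<u) refl = <-asym v<u u<v

    Beyond⇒≢ᵣ : ∀ {u v z} → key u < key v → Beyond u v z → z ≢ v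
    Beyond⇒≢ᵣ u<v (inj₁ v<u) refl = <-asym v<u u<v
    Beyond⇒≢ᵣ _   (inj₂ v<v) refl = <-irrefl refl v<v

    Between-or-Beyond : ∀ {u v z} → z ≢ u → z ≢ v → Between u v z ⊎ Beyond u v z
    Between-or-Beyond {u} {v} {z} z≢u z≢v with <-cmp (key z) (key u)
    ... | tri< z<u _ _  = inj₂ (inj₁ z<u)
    ... | tri≈ _ z≡u _  = ⊥-elim (z≢u (key-injective z≡u))
    ... | tri> _ _ u<z with <-cmp (key z) (key v)
    ...   | tri< z<v _ _ = inj₁ (u<z , z<v)
    ...   | tri≈ _ z≡v _ = ⊥-elim (z≢v (key-injective z≡v))
    ...   | tri> _ _ v<z = inj₂ (inj₂ v<z)

    Between-separated : ∀ {u v} → Adj G u v → SeparatedBy u v (Between u v)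
    Between-separated uv zz' z'≢u z'≢v (u<z , z<v) with Between-or-Beyond z'≢u z'≢v
    ... | inj₁ between     = between
    ... | inj₂ (inj₁ z'<u) = ⊥-elim (noncrossing _ _ _ _ (symm G zz') uv (z'<u , u<z , z<v))
    ... | inj₂ (inj₂ v<z') = ⊥-elim (noncrossing _ _ _ _ uv zz' (u<z , z<v , v<z'))

    module _ (connected : Connected G) {S : Subset n} (gp : GeneralPosition G S) where

      ¬opposite-sides-of-chord : ∀ {u v x t} → Adj G u v → u ∈ S → v ∈ S → x ∈ S → t ∈ S →
        Between u v x → ¬ Beyond u v t
      ¬opposite-sides-of-chord {u} {v} uv u∈S v∈S x∈S t∈S (u<x , x<v) beyond =
        general-position-¬separated connected gp (Between-separated uv) u∈S v∈S x∈S t∈S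
          (≢-sym (key<⇒≢ u<x)) (key<⇒≢ x<v) (Beyond⇒≢ₗ u<v beyond) (Beyond⇒≢ᵣ u<v beyond)
          (u<x , x<v) (Beyond⇒¬Between beyond)
        where
        u<v : key u < key v
        u<v = <-trans u<x x<v

      sorted-triangle-covers : ∀ {x y z d} → key x < key y → key y < key z →
        Triangle S x y z → d ∈ S → d ≡ x ⊎ d ≡ y ⊎ d ≡ z
      sorted-triangle-covers {x} {y} {z} {d} x<y y<z (x∈S , y∈S , z∈S , xy , yz , xz) d∈S
        with <-cmp (key d) (key x)
      ... | tri< d<x _ _ =
        ⊥-elim (¬opposite-sides-of-chord xz x∈S z∈S y∈S d∈S (x<y , y<z) (inj₁ d<x))
      ... | tri≈ _ d≡x _ = inj₁ (key-injective d≡x)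
      ... | tri> _ _ x<d with <-cmp (key d) (key y)
      ...   | tri< d<y _ _ =
        ⊥-elim (¬opposite-sides-of-chord xy x∈S y∈S d∈S z∈S (x<d , d<y) (inj₂ y<z))
      ...   | tri≈ _ d≡y _ = inj₂ (inj₁ (key-injective d≡y))
      ...   | tri> _ _ y<d with <-cmp (key d) (key z)
      ...     | tri< d<z _ _ =
        ⊥-elim (¬opposite-sides-of-chord yz y∈S z∈S d∈S x∈S (y<d , d<z) (inj₁ x<y))
      ...     | tri≈ _ d≡z _ = inj₂ (inj₂ (key-injective d≡z))
      ...     | tri> _ _ z<d =
        ⊥-elim (¬opposite-sides-of-chord xz x∈S z∈S y∈S d∈S (x<y , y<z) (inj₂ z<d))

      triangle-covers : ∀ {x y z d} → Triangle S x y z → d ∈ S → d ≡ x ⊎ d ≡ y ⊎ d ≡ z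
      triangle-covers {d = d} triangle@(_ , _ , _ , xy , yz , xz) d∈S =
        wlog-sorted key (λ x y z → Triangle S x y z → d ≡ x ⊎ d ≡ y ⊎ d ≡ z)
          (λ covers → assocʳ ∘ map₁ swap ∘ assocˡ ∘ covers ∘ Triangle-swap₁₂)
          (λ covers → map₂ swap ∘ covers ∘ Triangle-swap₂₃)
          (λ x<y y<z sorted → sorted-triangle-covers x<y y<z sorted d∈S)
          (adjacent⇒key≢ xy) (adjacent⇒key≢ yz) (adjacent⇒key≢ xz) triangle

mainTheorem4 : ∀ {n : ℕ} (G : Graph n) → Connected G → MaximalOuterplanar G →
    (S : Subset n) → GeneralPosition G S → ∣ S ∣ ≥ 4 → ¬ HasTriangleIn G S
mainTheorem4 G connected ((pos , pos-injective , noncrossing) , _) S gp 4≤∣S∣ (_ , _ , _ , triangle) =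
  ≤⇒≯ (∣p∣≤3 (triangle-covers G pos pos-injective noncrossing connected gp triangle)) 4≤∣S∣
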